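{- Let $g\ge 0$ and $n\ge 1$ be integers. There exists a bijection $$\eta\colon B^{I}_{g,n}\,\dot\cup\, B^{II}_{g,n}\longrightarrow U^{I}_{g+1,n+1}\,\dot\cup\, U^{II}_{g+1,n+1},$$ and $\eta$ restricts to bijections $\eta_I\colon B^{I}_{g,n}\to U^{I}_{g+1,n+1}$ and $\eta_{II}\colon B^{II}_{g,n}\to U^{II}_{g+1,n+1}$.
   Context: Planted unicellular maps. For an integer $n\ge 0$ let $H_n=\{r,1,2,\dots,2n,p\}$ (linearly ordered by $r<1<2<\dots<2n<p$), and let $\gamma_n$ be the cyclic permutation $(r,1,2,\dots,2n,p)$. A planted unicellular map with $n$ edges is a fixed-point-free involution $\alpha$ of $H_n$ with $\alpha(r)=p$; its vertex permutation is $\sigma=\alpha\circ\gamma_n$ (so $\alpha\circ\sigma=\gamma_n$ is the single face and $\sigma(p)=p$ is the plant). Its genus $g$ is defined by $V-(n+1)+1=2-2g$, $V$ the number of cycles of $\sigma$. $U_{g,n}$ is the set of planted unicellular maps with $n$ edges and genus $g$. For $\alpha\in U_{g+1,n+1}$ (on $H_{n+1}=\{r,1,\dots,2n+2,p\}$): - $\alpha\in U^{I}_{g+1,n+1}$ iff $1$ and $\alpha(1)$ lie in different cycles of $\sigma$ and there exists $k\in H_{n+1}$ with $1<k<\alpha(1)$ and $\alpha(1)<\alpha(k)$; - $\alpha\in U^{II}_{g+1,n+1}$ iff $1$ and $\alpha(1)$ lie in the same cycle of $\sigma$ and there exists $k$ with $1<k<\alpha(1)$ and $\alpha(1)<\alpha(k)$.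 Planted bicellular maps. For integers $n\ge1$ and $0\le m\le 2n$ let $L_{n,m}=\{r_1,1,\dots,m,p_1,r_2,m+1,\dots,2n,p_2\}$ (all distinct symbols) and let $\omega_{n,m}$ be the permutation with the two cycles $\omega_1=(r_1,1,2,\dots,m,p_1)$ and $\omega_2=(r_2,m+1,\dots,2n,p_2)$. A planted bicellular map with $n$ edges is a pair $(m,\beta)$ where $\beta$ is a fixed-point-free involution of $L_{n,m}$ with $\beta(r_1)=p_1$, $\beta(r_2)=p_2$, and such that there exists $x\in\{1,\dots,m\}$ with $\beta(x)\in\{m+1,\dots,2n\}$. Its vertex permutation is $\tau=\beta\circ\omega_{n,m}$; thus $\beta\circ\tau=\omega_{n,m}$ has exactly two cycles (the two faces), and $\tau$ fixes $p_1$ and $p_2$ (the two plants). Its genus $g$ is defined by $V-(n+2)+2=2-2g$, $V$ the number of cycles of $\tau$. $B_{g,n}$ is the set of planted bicellular maps with $n$ edges and genus $g$; $B^{I}_{g,n}$ is the subset in which the plants are attached to different vertices, i.e. $r_1$ and $r_2$ lie in different cycles of $\tau$, and $B^{II}_{g,n}=B_{g,n}\setminus B^{I}_{g,n}$. -}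

module Defs where

open import Data.Nat using (ℕ; zero; suc; _+_; _*_; _≤_)
open import Data.Nat.Properties using () renaming (_<?_ to _<ℕ?_)
open import Data.Fin using (Fin; zero; suc; toℕ; fromℕ; fromℕ<; _<_)
import Data.Fin.Properties as FinP
open import Data.Bool using (Bool; true; false; if_then_else_)
open import Data.List using (List; []; _∷_; length; upTo; allFin; map; _++_)
open import Data.Bool.ListAction using (any)
open import Data.Sum using (_⊎_; inj₁; inj₂)
import Data.Sum.Properties as SumP
open import Data.Product using (Σ; ∃; _×_; _,_; proj₁)
open import Relation.Nullary using (¬_; yes; no)
open import Relation.Nullary.Decidable using (⌊_⌋)
open import Relation.Binary using (Setoid; DecidableEquality)
open import Level using (0ℓ)
open import Relation.Binary.PropositionalEquality using (_≡_; _≢_; refl; sym; trans)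

iter : {A : Set} → (A → A) → ℕ → A → A
iter f zero x = x
iter f (suc k) x = f (iter f k x)

SameCycle : {A : Set} → (A → A) → A → A → Set
SameCycle σ x y = ∃ λ k → iter σ k x ≡ y

-- Number of cycles of a permutation σ of a finite set A, enumerated
-- (without repetition) by the list enum.  We count the elements of enum
-- that are not in the cycle of any earlier element (one leader per cycle).
-- Reachability is tested with at most |A| iterations, which suffices for
-- a permutation of a set with |A| elements.
module Cycles {A : Set} (_≟_ : DecidableEquality A) (enum : List A) (σ : A → A) where
  reach : A → A → Bool
  reach x y = any (λ i → ⌊ iter σ i x ≟ y ⌋) (upTo (length enum))

  go : List A → List A → ℕ
  go seen [] = 0
  go seen (x ∷ xs) =
    if any (λ y → reach y x) seen then go (x ∷ seen) xs else suc (go (x ∷ seen) xs)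

  numCycles : ℕ
  numCycles = go [] enum

next : {k : ℕ} → Fin (suc k) → Fin (suc k)
next {k} i with suc (toℕ i) <ℕ? suc k
... | yes p = fromℕ< p
... | no _ = zero

-- Planted unicellular maps
-- H_n = {r,1,…,2n,p} is encoded as Fin (2 + 2n): r = 0, label i = i, p = 2n+1;
-- the order of Fin is the linear order r < 1 < … < 2n < p.

H : ℕ → ℕ
H n = 2 + 2 * n

rH : {n : ℕ} → Fin (H n)
rH = zero

pH : {n : ℕ} → Fin (H n)
pH {n} = fromℕ (suc (2 * n))

-- the element 1 of H_n (meaningful for n ≥ 1)
oneH : {n : ℕ} → Fin (H n)
oneH = suc zero

γ : {n : ℕ} → Fin (H n) → Fin (H n)
γ = next

record UMap (n : ℕ) : Set where
  field
    α     : Fin (H n) → Fin (H n)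
    invol : ∀ x → α (α x) ≡ x
    fpf   : ∀ x → α x ≢ x
    plant : α (rH {n}) ≡ pH {n}

σU : {n : ℕ} → UMap n → Fin (H n) → Fin (H n)
σU {n} u x = UMap.α u (γ {n} x)

verticesU : {n : ℕ} → UMap n → ℕ
verticesU {n} u = Cycles.numCycles FinP._≟_ (allFin (H n)) (σU u)

-- genus g:  V - (n+1) + 1 = 2 - 2g,  i.e.  V + 2g = n + 2
HasGenusU : (g : ℕ) {n : ℕ} → UMap n → Set
HasGenusU g {n} u = verticesU u + 2 * g ≡ n + 2

CrossCond : {n : ℕ} → UMap n → Set
CrossCond {n} u = ∃ λ (k : Fin (H n)) →
  oneH {n} < k × k < UMap.α u (oneH {n}) × UMap.α u (oneH {n}) < UMap.α u k

U : ℕ → ℕ → Set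
U g n = Σ (UMap n) λ u → HasGenusU g u

IsUI : (g : ℕ) {n : ℕ} → UMap n → Set
IsUI g {n} u =
  HasGenusU g u × ¬ SameCycle (σU u) (oneH {n}) (UMap.α u (oneH {n})) × CrossCond u

IsUII : (g : ℕ) {n : ℕ} → UMap n → Set
IsUII g {n} u =
  HasGenusU g u × SameCycle (σU u) (oneH {n}) (UMap.α u (oneH {n})) × CrossCond u

USetoid : (n : ℕ) (P : UMap n → Set) → Setoid 0ℓ 0ℓ
USetoid n P = record
  { Carrier = Σ (UMap n) P
  ; _≈_ = λ a b → ∀ x → UMap.α (proj₁ a) x ≡ UMap.α (proj₁ b) x
  ; isEquivalence = record
    { refl = λ x → refl
    ; sym = λ e x → sym (e x)
    ; trans = λ e f x → trans (e x) (f x) } }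

-- Planted bicellular maps
-- With k = 2n - m, L_{n,m} is encoded as Fin (2+m) ⊎ Fin (2+k):
--   inj₁ 0 = r₁, inj₁ i = i (1 ≤ i ≤ m), inj₁ (m+1) = p₁,
--   inj₂ 0 = r₂, inj₂ j = m + j (1 ≤ j ≤ k), inj₂ (k+1) = p₂.

L : ℕ → ℕ → Set
L m k = Fin (2 + m) ⊎ Fin (2 + k)

r₁ : {m k : ℕ} → L m k
r₁ = inj₁ zero

p₁ : {m k : ℕ} → L m k
p₁ {m} = inj₁ (fromℕ (suc m))

r₂ : {m k : ℕ} → L m k
r₂ = inj₂ zero

p₂ : {m k : ℕ} → L m k
p₂ {k = k} = inj₂ (fromℕ (suc k))

ω : {m k : ℕ} → L m k → L m k
ω (inj₁ i) = inj₁ (next i)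
ω (inj₂ j) = inj₂ (next j)

enumL : (m k : ℕ) → List (L m k)
enumL m k = map inj₁ (allFin (2 + m)) ++ map inj₂ (allFin (2 + k))

record BMap (n : ℕ) : Set where
  field
    m k   : ℕ
    split : m + k ≡ 2 * n
    β     : L m k → L m k
    invol : ∀ x → β (β x) ≡ x
    fpf   : ∀ x → β x ≢ x
    plant₁ : β r₁ ≡ p₁
    plant₂ : β r₂ ≡ p₂
    link  : ∃ λ (i : Fin (2 + m)) → ∃ λ (j : Fin (2 + k)) →
              1 ≤ toℕ i × toℕ i ≤ m × 1 ≤ toℕ j × toℕ j ≤ k × β (inj₁ i) ≡ inj₂ j

τB : {n : ℕ} (b : BMap n) → L (BMap.m b) (BMap.k b) → L (BMap.m b) (BMap.k b)
τB b x = BMap.β b (ω x)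

verticesB : {n : ℕ} → BMap n → ℕ
verticesB b = Cycles.numCycles (SumP.≡-dec FinP._≟_ FinP._≟_)
                (enumL (BMap.m b) (BMap.k b)) (τB b)

-- genus g:  V - (n+2) + 2 = 2 - 2g,  i.e.  V + 2g = n + 2
HasGenusB : (g : ℕ) {n : ℕ} → BMap n → Set
HasGenusB g {n} b = verticesB b + 2 * g ≡ n + 2

IsBI : (g : ℕ) {n : ℕ} → BMap n → Set
IsBI g b = HasGenusB g b × ¬ SameCycle (τB b) r₁ r₂

IsBII : (g : ℕ) {n : ℕ} → BMap n → Set
IsBII g b = HasGenusB g b × SameCycle (τB b) r₁ r₂

data _≈B_ {n : ℕ} {P : BMap n → Set} : Σ (BMap n) P → Σ (BMap n) P → Set where
  sameB : ∀ {m k s s' β β' i i' f f' q₁ q₁' q₂ q₂' l l' h h'} →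
          (∀ x → β x ≡ β' x) →
          _≈B_ (record { m = m ; k = k ; split = s ; β = β ; invol = i ; fpf = f
                       ; plant₁ = q₁ ; plant₂ = q₂ ; link = l } , h)
               (record { m = m ; k = k ; split = s' ; β = β' ; invol = i' ; fpf = f'
                       ; plant₁ = q₁' ; plant₂ = q₂' ; link = l' } , h')

BSetoid : (n : ℕ) (P : BMap n → Set) → Setoid 0ℓ 0ℓ
BSetoid n P = record
  { Carrier = Σ (BMap n) P
  ; _≈_ = _≈B_
  ; isEquivalence = record
    { refl = sameB (λ x → refl)
    ; sym = λ { (sameB e) → sameB (λ x → sym (e x)) }
    ; trans = λ { (sameB e) (sameB e') → sameB (λ x → trans (e x) (e' x)) } } }

UIₛ UIIₛ : ℕ → ℕ → Setoid 0ℓ 0ℓ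
UIₛ g n = USetoid n (IsUI g)
UIIₛ g n = USetoid n (IsUII g)

BIₛ BIIₛ : ℕ → ℕ → Setoid 0ℓ 0ℓ
BIₛ g n = BSetoid n (IsBI g)
BIIₛ g n = BSetoid n (IsBII g)

module Submission where

-- Label L_{n,m} by H_{n+1} in the order r₂, r₁, 1, …, m, p₁, m+1, …, 2n, p₂ (call this
-- bijection ψ) and transport β to α = ψ β ψ⁻¹. The face γ of H_{n+1} is then ψ ω ψ⁻¹ composed
-- with the transposition of ψ r₂ and ψ p₁, so the two faces become one, and the vertex
-- permutation σ = α γ is ψ τ ψ⁻¹ composed with the same transposition. Because p₁ is a
-- plant, i.e. a fixed point of τ, this transposition merges the vertex {p₁} into the
-- vertex of r₂: σ has one cycle fewer than τ, which raises the genus by one, and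
-- 1 = ψ r₁ shares a σ-cycle with α 1 = ψ p₁ exactly when r₁ shares a τ-cycle with r₂.
-- An edge joining the two faces becomes an edge crossing the edge at 1. Conversely, a
-- unicellular map is cut back at the position m = α 1 − 2.

open import Defs
open import Data.Bool using (Bool; true; false; _∨_; if_then_else_; T)
import Data.Bool.Properties as Bool
open import Data.Bool.ListAction using (any; or)
open import Data.Empty using (⊥-elim)
open import Data.Fin as Fin using (Fin; toℕ; fromℕ; cast; splitAt; _↑ˡ_; _↑ʳ_)
import Data.Fin.Properties as Fin
open import Data.List using (List; []; _∷_; [_]; length; upTo; allFin; map; _++_)
open import Data.List.Properties using (map-∘; map-cong; length-tabulate; length-map)
open import Data.List.Membership.Propositional using (_∈_; lose)
open import Data.List.Membership.Propositional.Properties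
  using (∈-upTo⁺; ∈-allFin; ∈-map⁺; ∈-map⁻; ∈-++⁺ˡ; ∈-++⁺ʳ; ∈-∃++)
open import Data.List.Membership.Propositional.Properties.WithK using (unique∧set⇒bag)
open import Data.List.Relation.Binary.BagAndSetEquality using (∼bag⇒↭)
open import Data.List.Relation.Binary.Permutation.Propositional as ↭ using (_↭_)
open import Data.List.Relation.Binary.Permutation.Propositional.Properties
  using (shift; ∈-resp-↭; ↭-length)
open import Data.List.Relation.Unary.Any as Any using (here; there)
import Data.List.Relation.Unary.Any.Properties as Any
open import Data.List.Relation.Unary.Unique.Propositional using (Unique)
import Data.List.Relation.Unary.Unique.Propositional.Properties as Unique
open import Data.Nat using (ℕ; zero; suc; _+_; _*_; _∸_; _≤_; _<_; z≤n; s≤s; s≤s⁻¹; >-nonZero)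
open import Data.Nat.DivMod using (_%_; _/_; m≡m%n+[m/n]*n; m%n<n)
open import Data.Nat.Properties
open import Data.Product using (Σ; ∃; _×_; _,_; proj₁)
open import Data.Sum as Sum using (_⊎_; inj₁; inj₂)
open import Data.Sum.Properties using (inj₁-injective; inj₂-injective; ≡-dec)
open import Data.Sum.Relation.Binary.Pointwise as Pointwise using (_⊎ₛ_)
open import Function using (_∘_; id)
open import Function.Bundles using (mk⇔; Equivalence; Inverse)
open import Function.Definitions using (Injective)
open import Relation.Binary using (DecidableEquality)
open import Relation.Binary.PropositionalEquality hiding ([_])
open import Relation.Nullary using (¬_; yes; no; Dec)
open import Relation.Nullary.Decidable using (⌊_⌋; toWitness; fromWitness; recompute)

iter-+ : {A : Set} (f : A → A) (a b : ℕ) (x : A) → iter f (a + b) x ≡ iter f a (iter f b x)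
iter-+ f zero    b x = refl
iter-+ f (suc a) b x = cong f (iter-+ f a b x)

iter-injective : {A : Set} {f : A → A} →
                 Injective _≡_ _≡_ f → ∀ k → Injective _≡_ _≡_ (iter f k)
iter-injective f-inj zero    e = e
iter-injective f-inj (suc k) e = iter-injective f-inj k (f-inj e)

iter-conj : {A B : Set} {f : A → A} {g : B → B} {ψ : A → B} →
            (∀ a → g (ψ a) ≡ ψ (f a)) → ∀ k a → iter g k (ψ a) ≡ ψ (iter f k a)
iter-conj         c zero    a = refl
iter-conj {g = g} c (suc k) a = trans (cong g (iter-conj c k a)) (c _)

iter-cong : {A : Set} {f g : A → A} → (∀ x → f x ≡ g x) → ∀ k x → iter f k x ≡ iter g k x
iter-cong         h zero    x = refl
iter-cong {f = f} h (suc k) x = trans (cong f (iter-cong h k x)) (h _)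

iter-fixed : {A : Set} {f : A → A} {x : A} → f x ≡ x → ∀ k → iter f k x ≡ x
iter-fixed         h zero    = refl
iter-fixed {f = f} h (suc k) = trans (cong f (iter-fixed h k)) h

iter-period : {A : Set} {f : A → A} {x : A} {p : ℕ} →
              iter f p x ≡ x → ∀ q → iter f (q * p) x ≡ x
iter-period                 fp zero    = refl
iter-period {f = f} {x} {p} fp (suc q) =
  trans (iter-+ f p (q * p) x) (trans (cong (iter f p) (iter-period fp q)) fp)

module _ {A : Set} {σ : A → A} where

  sameCycle-refl : ∀ {x} → SameCycle σ x x
  sameCycle-refl = 0 , refl

  sameCycle-trans : ∀ {x y z} → SameCycle σ x y → SameCycle σ y z → SameCycle σ x z
  sameCycle-trans {x} (a , refl) (b , refl) = b + a , iter-+ σ b a x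

  sameCycle-cong : {σ′ : A → A} → (∀ x → σ x ≡ σ′ x) →
                   ∀ {x y} → SameCycle σ x y → SameCycle σ′ x y
  sameCycle-cong h (k , e) = k , trans (sym (iter-cong h k _)) e

involution-injective : {A : Set} {f : A → A} → (∀ x → f (f x) ≡ x) → Injective _≡_ _≡_ f
involution-injective {f = f} invol {x} {y} e = trans (sym (invol x)) (trans (cong f e) (invol y))

T-ext : {a b : Bool} → (T a → T b) → (T b → T a) → a ≡ b
T-ext {false} {false} _ _ = refl
T-ext {false} {true}  _ g = ⊥-elim (g _)
T-ext {true}  {false} f _ = ⊥-elim (f _)
T-ext {true}  {true}  _ _ = refl

T-from : {b : Bool} → b ≡ true → T b
T-from = Equivalence.from Bool.T-≡

∨-swap : ∀ a b c → a ∨ (b ∨ c) ≡ b ∨ (a ∨ c)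
∨-swap a b c =
  trans (sym (Bool.∨-assoc a b c)) (trans (cong (_∨ c) (Bool.∨-comm a b)) (Bool.∨-assoc b a c))

any-map : {A B : Set} (p : B → Bool) (f : A → B) (xs : List A) → any p (map f xs) ≡ any (p ∘ f) xs
any-map p f xs = cong or (sym (map-∘ xs))

any-cong : {A : Set} {p q : A → Bool} → (∀ x → p x ≡ q x) → ∀ xs → any p xs ≡ any q xs
any-cong h xs = cong or (map-cong h xs)

∈⇒↭∷ : {A : Set} {x : A} {xs : List A} → x ∈ xs → ∃ λ ys → xs ↭ x ∷ ys
∈⇒↭∷ x∈xs with ∈-∃++ x∈xs
... | ys , zs , refl = ys ++ zs , shift _ ys zs

∈⇒↭∷∷ : {A : Set} {x y : A} {xs : List A} →
        x ∈ xs → y ∈ xs → x ≢ y → ∃ λ zs → xs ↭ x ∷ y ∷ zs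
∈⇒↭∷∷ x∈xs y∈xs x≢y with ∈⇒↭∷ x∈xs
... | ys , xs↭x∷ys with ∈-resp-↭ xs↭x∷ys y∈xs
...   | here y≡x   = ⊥-elim (x≢y (sym y≡x))
...   | there y∈ys =
  let (zs , ys↭y∷zs) = ∈⇒↭∷ y∈ys in zs , ↭.trans xs↭x∷ys (↭.prep _ ys↭y∷zs)

skip : Bool → ℕ → ℕ
skip b c = if b then c else suc c

skip-comm : ∀ a b c → skip a (skip b c) ≡ skip b (skip a c)
skip-comm false false c = refl
skip-comm false true  c = refl
skip-comm true  false c = refl
skip-comm true  true  c = refl

module CycleCount {A : Set} (_≟_ : DecidableEquality A) (enum : List A) (σ : A → A) where
  open Cycles _≟_ enum σ public

  covered : List A → A → Bool
  covered seen x = any (λ y → reach y x) seen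

module _ {A : Set} {_≟₁_ _≟₂_ : DecidableEquality A} {enum₁ enum₂ : List A} {σ₁ σ₂ : A → A}
  where
  private
    module C₁ = CycleCount _≟₁_ enum₁ σ₁
    module C₂ = CycleCount _≟₂_ enum₂ σ₂

  go-sim : (R : List A → List A → Set) →
           (∀ {s t} x → R s t → R (x ∷ s) (x ∷ t)) →
           (∀ {s t} x → R s t → C₁.covered s x ≡ C₂.covered t x) →
           ∀ {s t} xs → R s t → C₁.go s xs ≡ C₂.go t xs
  go-sim R R-∷ R-covered []       r = refl
  go-sim R R-∷ R-covered (x ∷ xs) r =
    cong₂ skip (R-covered x r) (go-sim R R-∷ R-covered xs (R-∷ x r))

numCycles-cong : {A : Set} (_≟_ : DecidableEquality A) (enum : List A) {σ σ′ : A → A} →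
                 (∀ x → σ x ≡ σ′ x) →
                 Cycles.numCycles _≟_ enum σ ≡ Cycles.numCycles _≟_ enum σ′
numCycles-cong _≟_ enum {σ} {σ′} σ≡σ′ =
  go-sim _≡_ (λ x → cong (x ∷_)) (λ { {s} x refl → any-cong (λ y → same-reach y x) s }) enum refl
  where
  same-reach : ∀ y x → Cycles.reach _≟_ enum σ y x ≡ Cycles.reach _≟_ enum σ′ y x
  same-reach y x =
    any-cong (λ i → cong (λ t → ⌊ t ≟ x ⌋) (iter-cong σ≡σ′ i y)) (upTo (length enum))

module Conjugation {A B : Set} (_≟A_ : DecidableEquality A) (_≟B_ : DecidableEquality B)
  (enumA : List A) (enumB : List B) (τ : A → A) (σ : B → B) (ψ : A → B)
  (ψ-injective : Injective _≡_ _≡_ ψ) (conj : ∀ a → σ (ψ a) ≡ ψ (τ a))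
  (same-length : length enumA ≡ length enumB) where

  private
    module CA = CycleCount _≟A_ enumA τ
    module CB = CycleCount _≟B_ enumB σ

  reach-conj : ∀ y x → CB.reach (ψ y) (ψ x) ≡ CA.reach y x
  reach-conj y x rewrite same-length = any-cong
    (λ i → trans (cong (λ t → ⌊ t ≟B ψ x ⌋) (iter-conj {f = τ} {σ} {ψ} conj i y)) (decide-ψ _))
    (upTo (length enumB))
    where
    decide-ψ : ∀ a → ⌊ ψ a ≟B ψ x ⌋ ≡ ⌊ a ≟A x ⌋
    decide-ψ a with a ≟A x | ψ a ≟B ψ x
    ... | yes p | yes q = refl
    ... | yes p | no q  = ⊥-elim (q (cong ψ p))
    ... | no p  | yes q = ⊥-elim (p (ψ-injective q))
    ... | no p  | no q  = refl

  go-map : ∀ s xs → CB.go (map ψ s) (map ψ xs) ≡ CA.go s xs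
  go-map s []       = refl
  go-map s (x ∷ xs) =
    cong₂ skip (trans (any-map _ ψ s) (any-cong (λ y → reach-conj y x) s)) (go-map (x ∷ s) xs)

module _ {A : Set} {_≟_ : DecidableEquality A} {enum : List A} {σ : A → A} where
  open CycleCount _≟_ enum σ

  go-seen-cong : ∀ {s t} → (∀ z → covered s z ≡ covered t z) → ∀ xs → go s xs ≡ go t xs
  go-seen-cong h xs = go-sim (λ s t → ∀ z → covered s z ≡ covered t z)
    (λ x h z → cong (reach x z ∨_) (h z)) (λ x h → h x) xs h

  go-seen-swap : ∀ s x y xs → go (y ∷ x ∷ s) xs ≡ go (x ∷ y ∷ s) xs
  go-seen-swap s x y = go-seen-cong (λ z → ∨-swap (reach y z) (reach x z) (covered s z))

  module _ (reach-sym : ∀ {x y} → T (reach x y) → T (reach y x))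
           (reach-trans : ∀ {x y z} → T (reach x y) → T (reach y z) → T (reach x z)) where

    covered-resp : ∀ s {x y} → T (reach x y) → T (covered s x) → T (covered s y)
    covered-resp s r = Any.any⁺ _ ∘ Any.map (λ h → reach-trans h r) ∘ Any.any⁻ _ s

    go-swap : ∀ s x y xs → go s (x ∷ y ∷ xs) ≡ go s (y ∷ x ∷ xs)
    go-swap s x y xs with reach x y in xy | reach y x in yx
    ... | true  | true  =
      cong₂ skip (T-ext (covered-resp s (T-from xy)) (covered-resp s (T-from yx)))
                 (go-seen-swap s x y xs)
    ... | false | false =
      trans (skip-comm (covered s x) (covered s y) _)
            (cong (skip (covered s y) ∘ skip (covered s x)) (go-seen-swap s x y xs))
    ... | true  | false = ⊥-elim (subst T yx (reach-sym (T-from xy)))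
    ... | false | true  = ⊥-elim (subst T xy (reach-sym (T-from yx)))

    go-↭ : ∀ s {xs ys} → xs ↭ ys → go s xs ≡ go s ys
    go-↭ s ↭.refl                   = refl
    go-↭ s (↭.prep x p)             = cong (skip (covered s x)) (go-↭ (x ∷ s) p)
    go-↭ s (↭.swap {xs} {ys} x y p) =
      trans (cong (skip (covered s x) ∘ skip (covered (x ∷ s) y)) (go-↭ (y ∷ x ∷ s) p))
            (go-swap s x y ys)
    go-↭ s (↭.trans p q)            = trans (go-↭ s p) (go-↭ s q)

module FinPermutation {N : ℕ} (σ : Fin N → Fin N) (σ-injective : Injective _≡_ _≡_ σ) where
  open CycleCount Fin._≟_ (allFin N) σ

  period : ∀ x → ∃ λ p → 0 < p × p ≤ N × iter σ p x ≡ x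
  period x with Fin.pigeonhole (n<1+n N) (λ i → iter σ (toℕ i) x)
  ... | i , j , i<j , e =
    toℕ j ∸ toℕ i , m<n⇒0<n∸m i<j , ≤-trans (m∸n≤m (toℕ j) (toℕ i)) (s≤s⁻¹ (Fin.toℕ<n j)) ,
    iter-injective σ-injective (toℕ i) (begin
      iter σ (toℕ i) (iter σ (toℕ j ∸ toℕ i) x)  ≡⟨ iter-+ σ (toℕ i) _ x ⟨
      iter σ (toℕ i + (toℕ j ∸ toℕ i)) x         ≡⟨ cong (λ t → iter σ t x) (m+[n∸m]≡n (<⇒≤ i<j)) ⟩
      iter σ (toℕ j) x                           ≡⟨ e ⟨
      iter σ (toℕ i) x                           ∎)
    where open ≡-Reasoning

  sameCycle-bounded : ∀ {x y} → SameCycle σ x y → ∃ λ r → r < N × iter σ r x ≡ y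
  sameCycle-bounded {x} (k , refl) with period x
  ... | p , p>0 , p≤N , px = k % p , <-≤-trans (m%n<n k p) p≤N , (begin
      iter σ (k % p) x                        ≡⟨ cong (iter σ (k % p)) (iter-period px (k / p)) ⟨
      iter σ (k % p) (iter σ (k / p * p) x)   ≡⟨ iter-+ σ (k % p) (k / p * p) x ⟨
      iter σ (k % p + k / p * p) x            ≡⟨ cong (λ t → iter σ t x) (m≡m%n+[m/n]*n k p) ⟨
      iter σ k x                              ∎)
    where
    open ≡-Reasoning
    instance _ = >-nonZero p>0

  sameCycle-sym : ∀ {x y} → SameCycle σ x y → SameCycle σ y x
  sameCycle-sym {x} (k , refl) with period x
  ... | suc d , _ , _ , px = d * k , (begin
      iter σ (d * k) (iter σ k x)   ≡⟨ iter-+ σ (d * k) k x ⟨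
      iter σ (d * k + k) x          ≡⟨ cong (λ t → iter σ t x) dk+k≡k*[1+d] ⟩
      iter σ (k * suc d) x          ≡⟨ iter-period px k ⟩
      x                             ∎)
    where
    open ≡-Reasoning
    dk+k≡k*[1+d] : d * k + k ≡ k * suc d
    dk+k≡k*[1+d] = trans (+-comm (d * k) k) (*-comm (suc d) k)

  reach-sound : ∀ {x y} → T (reach x y) → SameCycle σ x y
  reach-sound {x} {y} h with Any.satisfied (Any.any⁻ _ (upTo (length (allFin N))) h)
  ... | i , w = i , toWitness w

  reach-complete : ∀ {x y} → SameCycle σ x y → T (reach x y)
  reach-complete {x} {y} c with sameCycle-bounded c
  ... | r , r<N , e = Any.any⁺ (λ i → ⌊ iter σ i x Fin.≟ y ⌋)
    (lose (∈-upTo⁺ (subst (r <_) (sym (length-tabulate id)) r<N)) (fromWitness e))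

  reach-true : ∀ {x y} → SameCycle σ x y → reach x y ≡ true
  reach-true c = T-ext _ (λ _ → reach-complete c)

  reach-false : ∀ {x y} → ¬ SameCycle σ x y → reach x y ≡ false
  reach-false ¬c = T-ext (¬c ∘ reach-sound) λ ()

  covered⁺ : ∀ {s y z} → y ∈ s → SameCycle σ y z → T (covered s z)
  covered⁺ y∈s c = Any.any⁺ _ (lose y∈s (reach-complete c))

  sameCycle? : ∀ x y → Dec (SameCycle σ x y)
  sameCycle? x y with reach x y in e
  ... | true  = yes (reach-sound (T-from e))
  ... | false = no (subst T e ∘ reach-complete)

  go-↭-cycles : ∀ {xs ys} → xs ↭ ys → go [] xs ≡ go [] ys
  go-↭-cycles = go-↭ (reach-complete ∘ sameCycle-sym ∘ reach-sound)
    (λ h h′ → reach-complete (sameCycle-trans (reach-sound h) (reach-sound h′))) []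

-- σ = τ ∘ (e f) with f a fixed point of τ: the transposition glues the singleton cycle (f)
-- onto the cycle of e.
module MergeFixedPoint {N : ℕ} (τ σ : Fin N → Fin N)
  (τ-injective : Injective _≡_ _≡_ τ) (σ-injective : Injective _≡_ _≡_ σ)
  {e f : Fin N} (f≢e : f ≢ e) (τf : τ f ≡ f) (σe : σ e ≡ f) (σf : σ f ≡ τ e)
  (σ≡τ : ∀ x → x ≢ e → x ≢ f → σ x ≡ τ x) where

  private
    module Pτ = FinPermutation τ τ-injective
    module Pσ = FinPermutation σ σ-injective
    module Cτ = CycleCount Fin._≟_ (allFin N) τ
    module Cσ = CycleCount Fin._≟_ (allFin N) σ

  τ-cycle-of-f : ∀ {z} → SameCycle τ f z → z ≡ f
  τ-cycle-of-f (k , refl) = iter-fixed τf k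

  e≁τf : ¬ SameCycle τ e f
  e≁τf c = f≢e (sym (τ-cycle-of-f (Pτ.sameCycle-sym c)))

  τ⇒σ : ∀ {z} → SameCycle τ e z → SameCycle σ e z
  τ⇒σ (k , refl) = go k
    where
    go : ∀ k → SameCycle σ e (iter τ k e)
    go zero = sameCycle-refl
    go (suc k) with iter τ k e Fin.≟ e
    ... | yes w≡e rewrite w≡e = 2 , trans (cong σ σe) σf
    ... | no  w≢e = sameCycle-trans (go k) (1 , σ≡τ _ w≢e (λ w≡f → e≁τf (k , w≡f)))

  σ⇒τ : ∀ {z} → SameCycle σ e z → SameCycle τ e z ⊎ z ≡ f
  σ⇒τ (k , refl) = go k
    where
    go : ∀ k → SameCycle τ e (iter σ k e) ⊎ iter σ k e ≡ f
    go zero = inj₁ sameCycle-refl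
    go (suc k) with go k
    ... | inj₂ w≡f = inj₁ (1 , trans (sym σf) (cong σ (sym w≡f)))
    ... | inj₁ c with iter σ k e Fin.≟ e
    ...   | yes w≡e = inj₂ (trans (cong σ w≡e) σe)
    ...   | no  w≢e = inj₁ (sameCycle-trans c (1 , sym (σ≡τ _ w≢e w≢f)))
      where
      w≢f : iter σ k e ≢ f
      w≢f w≡f = e≁τf (subst (SameCycle τ e) w≡f c)

  iter-away-from-e : ∀ {y} → ¬ SameCycle σ e y → ∀ i → iter σ i y ≡ iter τ i y
  iter-away-from-e         e≁y zero    = refl
  iter-away-from-e {y} e≁y (suc i) = trans (σ≡τ _ w≢e w≢f) (cong τ (iter-away-from-e e≁y i))
    where
    e≁w : ¬ SameCycle σ e (iter σ i y)
    e≁w c = e≁y (sameCycle-trans c (Pσ.sameCycle-sym (i , refl)))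
    w≢e : iter σ i y ≢ e
    w≢e w≡e = e≁w (0 , sym w≡e)
    w≢f : iter σ i y ≢ f
    w≢f w≡f = e≁w (1 , trans σe (sym w≡f))

  sameCycle-away-from-e : ∀ {y z} → ¬ SameCycle σ e z → SameCycle σ y z → SameCycle τ y z
  sameCycle-away-from-e e≁z (k , refl) =
    k , sym (iter-away-from-e (λ c → e≁z (sameCycle-trans c (k , refl))) k)

  sameCycle-away-from-e⁻ : ∀ {y z} → ¬ SameCycle σ e z → SameCycle τ y z → SameCycle σ y z
  sameCycle-away-from-e⁻ {y} e≁z (k , refl) = k , iter-away-from-e e≁y k
    where
    e≁y : ¬ SameCycle σ e y
    e≁y c with σ⇒τ c
    ... | inj₁ c′   = e≁z (τ⇒σ (sameCycle-trans c′ (k , refl)))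
    ... | inj₂ refl = e≁z (subst (SameCycle σ e) (sym (τ-cycle-of-f (k , refl))) (1 , σe))

  sameCycle-f⇒e : ∀ {x} → x ≢ f → SameCycle σ x f → SameCycle τ x e
  sameCycle-f⇒e x≢f c with σ⇒τ (sameCycle-trans (1 , σe) (Pσ.sameCycle-sym c))
  ... | inj₁ c′  = Pτ.sameCycle-sym c′
  ... | inj₂ x≡f = ⊥-elim (x≢f x≡f)

  sameCycle-e⇒f : ∀ {x} → SameCycle τ x e → SameCycle σ x f
  sameCycle-e⇒f c = sameCycle-trans (Pσ.sameCycle-sym (τ⇒σ (Pτ.sameCycle-sym c))) (1 , σe)

  covered-agree : ∀ s → e ∈ s → f ∈ s → ∀ z → Cτ.covered s z ≡ Cσ.covered s z
  covered-agree s e∈s f∈s z with Pσ.sameCycle? e z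
  ... | yes e~z = T-ext (λ _ → Pσ.covered⁺ e∈s e~z) (λ _ → τ-covered (σ⇒τ e~z))
    where
    τ-covered : SameCycle τ e z ⊎ z ≡ f → T (Cτ.covered s z)
    τ-covered (inj₁ c)    = Pτ.covered⁺ e∈s c
    τ-covered (inj₂ refl) = Pτ.covered⁺ f∈s sameCycle-refl
  ... | no e≁z = T-ext τ⇒σ-covered σ⇒τ-covered
    where
    τ⇒σ-covered : T (Cτ.covered s z) → T (Cσ.covered s z)
    τ⇒σ-covered = Any.any⁺ _ ∘ Any.map (Pσ.reach-complete ∘ sameCycle-away-from-e⁻ e≁z ∘ Pτ.reach-sound)
                ∘ Any.any⁻ _ s
    σ⇒τ-covered : T (Cσ.covered s z) → T (Cτ.covered s z)
    σ⇒τ-covered = Any.any⁺ _ ∘ Any.map (Pτ.reach-complete ∘ sameCycle-away-from-e e≁z ∘ Pσ.reach-sound)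
                ∘ Any.any⁻ _ s

  go-agree : ∀ {s} xs → e ∈ s → f ∈ s → Cτ.go s xs ≡ Cσ.go s xs
  go-agree xs e∈s f∈s = go-sim (λ s t → s ≡ t × e ∈ s × f ∈ s)
    (λ { x (refl , e∈s , f∈s) → refl , there e∈s , there f∈s })
    (λ { x (refl , e∈s , f∈s) → covered-agree _ e∈s f∈s x })
    xs (refl , e∈s , f∈s)

  -- Enumerate f and e first: under τ both start a new cycle, under σ only f does.
  numCycles-merge : Cτ.numCycles ≡ suc Cσ.numCycles
  numCycles-merge with ∈⇒↭∷∷ (∈-allFin f) (∈-allFin e) f≢e
  ... | rest , all↭f∷e∷rest = begin
    Cτ.go [] (allFin N)                   ≡⟨ Pτ.go-↭-cycles all↭f∷e∷rest ⟩
    suc (skip (Cτ.covered [ f ] e) τ-rest) ≡⟨ cong (λ c → suc (skip c τ-rest)) e-new-under-τ ⟩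
    suc (suc τ-rest)                      ≡⟨ cong (suc ∘ suc) (go-agree rest (here refl) f∈[e,f]) ⟩
    suc (suc σ-rest)                      ≡⟨ cong (λ c → suc (suc (skip c σ-rest))) e-old-under-σ ⟨
    suc (Cσ.go [] (f ∷ e ∷ rest))         ≡⟨ cong suc (Pσ.go-↭-cycles all↭f∷e∷rest) ⟨
    suc (Cσ.go [] (allFin N))             ∎
    where
    open ≡-Reasoning
    τ-rest = Cτ.go (e ∷ f ∷ []) rest
    σ-rest = Cσ.go (e ∷ f ∷ []) rest
    f∈[e,f] : f ∈ e ∷ f ∷ []
    f∈[e,f] = there (here refl)
    e-new-under-τ : Cτ.covered [ f ] e ≡ false
    e-new-under-τ = trans (Bool.∨-identityʳ _) (Pτ.reach-false (e≁τf ∘ Pτ.sameCycle-sym))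
    e-old-under-σ : Cσ.covered [ f ] e ≡ true
    e-old-under-σ = trans (Bool.∨-identityʳ _) (Pσ.reach-true (Pσ.sameCycle-sym (1 , σe)))

toℕ-next : ∀ {K} (i : Fin (suc K)) → suc (toℕ i) < suc K → toℕ (next i) ≡ suc (toℕ i)
toℕ-next {K} i lt with suc (toℕ i) <? suc K
... | yes p = Fin.toℕ-fromℕ< p
... | no ¬p = ⊥-elim (¬p lt)

toℕ-next-≢ : ∀ {K} (i : Fin (suc K)) → toℕ i ≢ K → toℕ (next i) ≡ suc (toℕ i)
toℕ-next-≢ i i≢K = toℕ-next i (s≤s (≤∧≢⇒< (s≤s⁻¹ (Fin.toℕ<n i)) i≢K))

next-suc : ∀ {K} {i j : Fin (suc K)} → toℕ j ≡ suc (toℕ i) → next i ≡ j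
next-suc {i = i} {j} e = Fin.toℕ-injective (trans (toℕ-next i (subst (_< _) e (Fin.toℕ<n j))) (sym e))

next-last : ∀ {K} (i : Fin (suc K)) → toℕ i ≡ K → next i ≡ Fin.zero
next-last {K} i e with suc (toℕ i) <? suc K
... | yes p = ⊥-elim (<-irrefl refl (subst (λ t → suc t < suc K) e p))
... | no _  = refl

next-injective : ∀ {K} → Injective _≡_ _≡_ (next {K})
next-injective {K} {i} {j} e with suc (toℕ i) <? suc K | suc (toℕ j) <? suc K
... | yes p | yes q = Fin.toℕ-injective (suc-injective
  (trans (sym (Fin.toℕ-fromℕ< p)) (trans (cong toℕ e) (Fin.toℕ-fromℕ< q))))
... | yes p | no _  = ⊥-elim (0≢1+n (trans (sym (cong toℕ e)) (Fin.toℕ-fromℕ< p)))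
... | no _  | yes q = ⊥-elim (0≢1+n (trans (cong toℕ e) (Fin.toℕ-fromℕ< q)))
... | no ¬p | no ¬q = Fin.toℕ-injective (trans (is-last i ¬p) (sym (is-last j ¬q)))
  where
  is-last : ∀ (x : Fin (suc K)) → ¬ suc (toℕ x) < suc K → toℕ x ≡ K
  is-last x ¬lt = ≤-antisym (s≤s⁻¹ (Fin.toℕ<n x)) (s≤s⁻¹ (≮⇒≥ ¬lt))

ω-injective : ∀ {m k} → Injective _≡_ _≡_ (ω {m} {k})
ω-injective {x = inj₁ i} {inj₁ j} e = cong inj₁ (next-injective (inj₁-injective e))
ω-injective {x = inj₂ i} {inj₂ j} e = cong inj₂ (next-injective (inj₂-injective e))

ω-p₁ : ∀ {m k} → ω (p₁ {m} {k}) ≡ r₁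
ω-p₁ {m} = cong inj₁ (next-last (fromℕ (suc m)) (Fin.toℕ-fromℕ (suc m)))

ω-p₂ : ∀ {m k} → ω (p₂ {m} {k}) ≡ r₂
ω-p₂ {k = k} = cong inj₂ (next-last (fromℕ (suc k)) (Fin.toℕ-fromℕ (suc k)))

enumL-complete : ∀ {m k} (x : L m k) → x ∈ enumL m k
enumL-complete {m} (inj₁ i) = ∈-++⁺ˡ (∈-map⁺ inj₁ (∈-allFin i))
enumL-complete {m} (inj₂ j) = ∈-++⁺ʳ (map inj₁ (allFin (2 + m))) (∈-map⁺ inj₂ (∈-allFin j))

enumL-unique : ∀ m k → Unique (enumL m k)
enumL-unique m k = Unique.++⁺ (Unique.map⁺ inj₁-injective (Unique.allFin⁺ _))
                              (Unique.map⁺ inj₂-injective (Unique.allFin⁺ _)) disjoint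
  where
  disjoint : ∀ {v} → ¬ (v ∈ map inj₁ (allFin (2 + m)) × v ∈ map inj₂ (allFin (2 + k)))
  disjoint (p , q) with ∈-map⁻ inj₁ p | ∈-map⁻ inj₂ q
  ... | _ , _ , refl | _ , _ , ()

module _ {n : ℕ} (u : UMap n) where
  open UMap u

  α-pH : α (pH {n}) ≡ rH {n}
  α-pH = trans (cong α (sym plant)) (invol (rH {n}))

  α≡pH⇒≡rH : ∀ {x} → α x ≡ pH {n} → x ≡ rH {n}
  α≡pH⇒≡rH {x} e = trans (sym (invol x)) (trans (cong α e) α-pH)

module Relabel (n m k : ℕ) .(split : m + k ≡ 2 * n) where

  position : L m k → ℕ
  position (inj₁ i)           = suc (toℕ i)
  position (inj₂ Fin.zero)    = 0
  position (inj₂ (Fin.suc j)) = 3 + (m + toℕ j)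

  private
    N₀ : ℕ
    N₀ = suc ((2 + m) + suc k)

    ψ₀ : L m k → Fin N₀
    ψ₀ (inj₁ i)           = Fin.suc (i ↑ˡ suc k)
    ψ₀ (inj₂ Fin.zero)    = Fin.zero
    ψ₀ (inj₂ (Fin.suc j)) = Fin.suc ((2 + m) ↑ʳ j)

    ψ₀⁻¹ : Fin N₀ → L m k
    ψ₀⁻¹ Fin.zero    = inj₂ Fin.zero
    ψ₀⁻¹ (Fin.suc t) = Sum.map₂ Fin.suc (splitAt (2 + m) t)

    ψ₀⁻¹-ψ₀ : ∀ x → ψ₀⁻¹ (ψ₀ x) ≡ x
    ψ₀⁻¹-ψ₀ (inj₁ i)           = cong (Sum.map₂ Fin.suc) (Fin.splitAt-↑ˡ (2 + m) i (suc k))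
    ψ₀⁻¹-ψ₀ (inj₂ Fin.zero)    = refl
    ψ₀⁻¹-ψ₀ (inj₂ (Fin.suc j)) = cong (Sum.map₂ Fin.suc) (Fin.splitAt-↑ʳ (2 + m) (suc k) j)

    ψ₀-ψ₀⁻¹ : ∀ t → ψ₀ (ψ₀⁻¹ t) ≡ t
    ψ₀-ψ₀⁻¹ Fin.zero    = refl
    ψ₀-ψ₀⁻¹ (Fin.suc t) =
      trans (ψ₀-join (splitAt (2 + m) t)) (cong Fin.suc (Fin.join-splitAt (2 + m) (suc k) t))
      where
      ψ₀-join : ∀ s → ψ₀ (Sum.map₂ Fin.suc s) ≡ Fin.suc (Fin.join (2 + m) (suc k) s)
      ψ₀-join (inj₁ i) = refl
      ψ₀-join (inj₂ j) = refl

    toℕ-ψ₀ : ∀ x → toℕ (ψ₀ x) ≡ position x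
    toℕ-ψ₀ (inj₁ i)           = cong suc (Fin.toℕ-↑ˡ i (suc k))
    toℕ-ψ₀ (inj₂ Fin.zero)    = refl
    toℕ-ψ₀ (inj₂ (Fin.suc j)) = cong suc (Fin.toℕ-↑ʳ (2 + m) j)

  2+m+k≡2[1+n] : m + k ≡ 2 * n → 2 + (m + k) ≡ 2 * suc n
  2+m+k≡2[1+n] m+k≡2n = trans (cong (2 +_) m+k≡2n) (sym (*-suc 2 n))

  size : m + k ≡ 2 * n → N₀ ≡ H (suc n)
  size m+k≡2n = cong (2 +_) (trans (cong suc (+-suc m k)) (2+m+k≡2[1+n] m+k≡2n))

  ψ : L m k → Fin (H (suc n))
  ψ = cast (size split) ∘ ψ₀

  ψ⁻¹ : Fin (H (suc n)) → L m k
  ψ⁻¹ = ψ₀⁻¹ ∘ cast (sym (size split))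

  ψ⁻¹-ψ : ∀ x → ψ⁻¹ (ψ x) ≡ x
  ψ⁻¹-ψ x =
    trans (cong ψ₀⁻¹ (Fin.cast-involutive (sym (size split)) (size split) (ψ₀ x))) (ψ₀⁻¹-ψ₀ x)

  ψ-ψ⁻¹ : ∀ t → ψ (ψ⁻¹ t) ≡ t
  ψ-ψ⁻¹ t = trans (cong (cast (size split)) (ψ₀-ψ₀⁻¹ (cast (sym (size split)) t)))
                  (Fin.cast-involutive (size split) (sym (size split)) t)

  ψ-injective : Injective _≡_ _≡_ ψ
  ψ-injective {x} {y} e = trans (sym (ψ⁻¹-ψ x)) (trans (cong ψ⁻¹ e) (ψ⁻¹-ψ y))

  ψ⁻¹-injective : Injective _≡_ _≡_ ψ⁻¹
  ψ⁻¹-injective {x} {y} e = trans (sym (ψ-ψ⁻¹ x)) (trans (cong ψ e) (ψ-ψ⁻¹ y))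

  toℕ-ψ : ∀ x → toℕ (ψ x) ≡ position x
  toℕ-ψ x = trans (Fin.toℕ-cast (size split) (ψ₀ x)) (toℕ-ψ₀ x)

  position-inj₂ : ∀ (j : Fin (2 + k)) → 1 ≤ toℕ j → position (inj₂ j) ≡ 2 + m + toℕ j
  position-inj₂ (Fin.suc j) _ = cong (2 +_) (sym (+-suc m (toℕ j)))

  toℕ-ψ-p₁ : toℕ (ψ p₁) ≡ 2 + m
  toℕ-ψ-p₁ = trans (toℕ-ψ p₁) (cong suc (Fin.toℕ-fromℕ (suc m)))

  ψ-r₁ : ψ r₁ ≡ oneH {suc n}
  ψ-r₁ = Fin.toℕ-injective (toℕ-ψ r₁)

  ψ-r₂ : ψ r₂ ≡ rH {suc n}
  ψ-r₂ = Fin.toℕ-injective (toℕ-ψ r₂)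

  ψ-p₂ : ψ p₂ ≡ pH {suc n}
  ψ-p₂ = Fin.toℕ-injective (begin
    toℕ (ψ p₂)               ≡⟨ toℕ-ψ p₂ ⟩
    3 + (m + toℕ (fromℕ k))  ≡⟨ cong (λ t → 3 + (m + t)) (Fin.toℕ-fromℕ k) ⟩
    suc (2 + (m + k))        ≡⟨ cong suc (2+m+k≡2[1+n] (recompute (m + k ≟ 2 * n) split)) ⟩
    suc (2 * suc n)          ≡⟨ Fin.toℕ-fromℕ (suc (2 * suc n)) ⟨
    toℕ (pH {suc n})         ∎)
    where open ≡-Reasoning

  suc-last : ∀ (j : Fin (suc k)) → toℕ j ≡ k → inj₂ (Fin.suc j) ≡ p₂ {m} {k}
  suc-last j j≡k = cong inj₂ (Fin.toℕ-injective (cong suc (trans j≡k (sym (Fin.toℕ-fromℕ k)))))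

  next-ψ-r₂ : next (ψ r₂) ≡ ψ r₁
  next-ψ-r₂ = next-suc (trans (toℕ-ψ r₁) (cong suc (sym (toℕ-ψ r₂))))

  next-ψ-p₁ : next (ψ p₁) ≡ ψ (ω r₂)
  next-ψ-p₁ = next-suc (begin
    toℕ (ψ (inj₂ (Fin.suc Fin.zero)))  ≡⟨ toℕ-ψ (inj₂ (Fin.suc Fin.zero)) ⟩
    3 + (m + 0)                        ≡⟨ cong (3 +_) (+-identityʳ m) ⟩
    suc (2 + m)                        ≡⟨ cong suc toℕ-ψ-p₁ ⟨
    suc (toℕ (ψ p₁))                   ∎)
    where open ≡-Reasoning

  next-ψ : ∀ y → y ≢ p₁ → y ≢ r₂ → next (ψ y) ≡ ψ (ω y)
  next-ψ (inj₁ i) y≢p₁ _ = next-suc (begin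
    toℕ (ψ (inj₁ (next i)))  ≡⟨ toℕ-ψ (inj₁ (next i)) ⟩
    suc (toℕ (next i))       ≡⟨ cong suc (toℕ-next-≢ i i≢last) ⟩
    suc (suc (toℕ i))        ≡⟨ cong suc (toℕ-ψ (inj₁ i)) ⟨
    suc (toℕ (ψ (inj₁ i)))   ∎)
    where
    open ≡-Reasoning
    i≢last : toℕ i ≢ suc m
    i≢last e = y≢p₁ (cong inj₁ (Fin.toℕ-injective (trans e (sym (Fin.toℕ-fromℕ (suc m))))))
  next-ψ (inj₂ Fin.zero) _ y≢r₂ = ⊥-elim (y≢r₂ refl)
  next-ψ (inj₂ (Fin.suc j)) _ _ with toℕ j ≟ k
  ... | no j≢k = next-suc (begin
    toℕ (ψ (inj₂ sj′))           ≡⟨ toℕ-ψ (inj₂ sj′) ⟩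
    position (inj₂ sj′)          ≡⟨ position-inj₂ sj′ (≤-trans (s≤s z≤n) (≤-reflexive (sym toℕ-sj′))) ⟩
    2 + m + toℕ sj′              ≡⟨ cong (2 + m +_) toℕ-sj′ ⟩
    2 + m + suc (suc (toℕ j))    ≡⟨ cong (2 +_) (trans (+-suc m _) (cong suc (+-suc m (toℕ j)))) ⟩
    suc (position (inj₂ sj))     ≡⟨ cong suc (toℕ-ψ (inj₂ sj)) ⟨
    suc (toℕ (ψ (inj₂ sj)))      ∎)
    where
    open ≡-Reasoning
    sj = Fin.suc j
    sj′ = next sj
    toℕ-sj′ : toℕ sj′ ≡ suc (suc (toℕ j))
    toℕ-sj′ = toℕ-next-≢ sj (j≢k ∘ suc-injective)
  ... | yes j≡k = begin
    next (ψ (inj₂ (Fin.suc j)))  ≡⟨ cong (next ∘ ψ) (suc-last j j≡k) ⟩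
    next (ψ p₂)                  ≡⟨ cong next ψ-p₂ ⟩
    next (pH {suc n})            ≡⟨ next-last (pH {suc n}) (Fin.toℕ-fromℕ _) ⟩
    rH {suc n}                   ≡⟨ ψ-r₂ ⟨
    ψ r₂                         ≡⟨ cong ψ ω-p₂ ⟨
    ψ (ω p₂)                     ≡⟨ cong (ψ ∘ ω) (suc-last j j≡k) ⟨
    ψ (ω (inj₂ (Fin.suc j)))     ∎
    where open ≡-Reasoning

  map-ψ-enumL : map ψ (enumL m k) ↭ allFin (H (suc n))
  map-ψ-enumL = ∼bag⇒↭ (unique∧set⇒bag
    (Unique.map⁺ ψ-injective (enumL-unique m k)) (Unique.allFin⁺ _)
    (λ {t} → mk⇔ (λ _ → ∈-allFin t)
                 (λ _ → subst (_∈ _) (ψ-ψ⁻¹ t) (∈-map⁺ ψ (enumL-complete (ψ⁻¹ t))))))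

module Glue {n : ℕ} (b : BMap n) where
  open BMap b
  open Relabel n m k split public

  α : Fin (H (suc n)) → Fin (H (suc n))
  α = ψ ∘ β ∘ ψ⁻¹

  α-ψ : ∀ y → α (ψ y) ≡ ψ (β y)
  α-ψ y = cong (ψ ∘ β) (ψ⁻¹-ψ y)

  α-involutive : ∀ x → α (α x) ≡ x
  α-involutive x = trans (α-ψ _) (trans (cong ψ (invol (ψ⁻¹ x))) (ψ-ψ⁻¹ x))

  α-fixed-point-free : ∀ x → α x ≢ x
  α-fixed-point-free x αx≡x = fpf (ψ⁻¹ x) (ψ-injective (trans αx≡x (sym (ψ-ψ⁻¹ x))))

  glued : UMap (suc n)
  glued = record
    { α     = α
    ; invol = α-involutive
    ; fpf   = α-fixed-point-free
    ; plant = trans (cong α (sym ψ-r₂)) (trans (α-ψ r₂) (trans (cong ψ plant₂) ψ-p₂))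
    }

  α-one : α (oneH {suc n}) ≡ ψ p₁
  α-one = trans (cong α (sym ψ-r₁)) (trans (α-ψ r₁) (cong ψ plant₁))

  toℕ-α-one : toℕ (α (oneH {suc n})) ≡ 2 + m
  toℕ-α-one = trans (cong toℕ α-one) toℕ-ψ-p₁

  τ′ : Fin (H (suc n)) → Fin (H (suc n))
  τ′ = ψ ∘ τB b ∘ ψ⁻¹

  τ′-ψ : ∀ y → τ′ (ψ y) ≡ ψ (τB b y)
  τ′-ψ y = cong (ψ ∘ τB b) (ψ⁻¹-ψ y)

  τ′-injective : Injective _≡_ _≡_ τ′
  τ′-injective e = ψ⁻¹-injective (ω-injective (involution-injective {f = β} invol (ψ-injective e)))

  σ-injective : Injective _≡_ _≡_ (σU glued)
  σ-injective e = next-injective (involution-injective {f = α} α-involutive e)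

  σ≡τ′ : ∀ x → x ≢ ψ r₂ → x ≢ ψ p₁ → σU glued x ≡ τ′ x
  σ≡τ′ x x≢e x≢f = begin
    α (next x)       ≡⟨ cong (α ∘ next) (ψ-ψ⁻¹ x) ⟨
    α (next (ψ y))   ≡⟨ cong α (next-ψ y (x≢f ∘ ψ-image) (x≢e ∘ ψ-image)) ⟩
    α (ψ (ω y))      ≡⟨ α-ψ (ω y) ⟩
    ψ (β (ω y))      ≡⟨ τ′-ψ y ⟨
    τ′ (ψ y)         ≡⟨ cong τ′ (ψ-ψ⁻¹ x) ⟩
    τ′ x             ∎
    where
    open ≡-Reasoning
    y = ψ⁻¹ x
    ψ-image : ∀ {z} → y ≡ z → x ≡ ψ z
    ψ-image refl = sym (ψ-ψ⁻¹ x)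

  module Merge = MergeFixedPoint τ′ (σU glued) τ′-injective σ-injective {e = ψ r₂} {f = ψ p₁}
    (λ f≡e → 0≢1+n (trans (sym (toℕ-ψ r₂)) (trans (cong toℕ (sym f≡e)) toℕ-ψ-p₁)))
    (trans (τ′-ψ p₁) (trans (cong (ψ ∘ β) ω-p₁) (cong ψ plant₁)))
    (trans (cong α next-ψ-r₂) (trans (α-ψ r₁) (cong ψ plant₁)))
    (trans (cong α next-ψ-p₁) (trans (α-ψ (ω r₂)) (sym (τ′-ψ r₂))))
    σ≡τ′

  vertices-glued : verticesB b ≡ suc (verticesU glued)
  vertices-glued = begin
    verticesB b                                   ≡⟨ τ-via-ψ [] (enumL m k) ⟨
    Cycles.go Fin._≟_ (allFin _) τ′ [] (map ψ (enumL m k))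
                                                  ≡⟨ FinPermutation.go-↭-cycles τ′ τ′-injective map-ψ-enumL ⟩
    Cycles.numCycles Fin._≟_ (allFin _) τ′        ≡⟨ Merge.numCycles-merge ⟩
    suc (verticesU glued)                         ∎
    where
    open ≡-Reasoning
    length-enumL : length (enumL m k) ≡ length (allFin (H (suc n)))
    length-enumL = trans (sym (length-map ψ (enumL m k))) (↭-length map-ψ-enumL)
    open Conjugation (≡-dec Fin._≟_ Fin._≟_) Fin._≟_ (enumL m k) (allFin _) (τB b) τ′ ψ
                     ψ-injective τ′-ψ length-enumL renaming (go-map to τ-via-ψ)

  sameCycle-τ′⇒τB : ∀ {x y} → SameCycle τ′ (ψ x) (ψ y) → SameCycle (τB b) x y
  sameCycle-τ′⇒τB {x} (i , e) = i , ψ-injective (trans (sym (iter-conj {f = τB b} τ′-ψ i x)) e)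

  sameCycle-τB⇒τ′ : ∀ {x y} → SameCycle (τB b) x y → SameCycle τ′ (ψ x) (ψ y)
  sameCycle-τB⇒τ′ {x} (i , e) = i , trans (iter-conj {f = τB b} τ′-ψ i x) (cong ψ e)

  sameCycle-one⇒plants : SameCycle (σU glued) (oneH {suc n}) (α (oneH {suc n})) →
                         SameCycle (τB b) r₁ r₂
  sameCycle-one⇒plants c =
    sameCycle-τ′⇒τB (Merge.sameCycle-f⇒e r₁≢p₁
      (subst₂ (SameCycle (σU glued)) (sym ψ-r₁) α-one c))
    where
    r₁≢p₁ : ψ r₁ ≢ ψ p₁
    r₁≢p₁ e = 0≢1+n (suc-injective (trans (sym (toℕ-ψ r₁)) (trans (cong toℕ e) toℕ-ψ-p₁)))

  sameCycle-plants⇒one : SameCycle (τB b) r₁ r₂ →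
                         SameCycle (σU glued) (oneH {suc n}) (α (oneH {suc n}))
  sameCycle-plants⇒one c =
    subst₂ (SameCycle (σU glued)) ψ-r₁ (sym α-one) (Merge.sameCycle-e⇒f (sameCycle-τB⇒τ′ c))

  cross-glued : CrossCond glued
  cross-glued with link
  ... | i , j , 1≤i , i≤m , 1≤j , _ , βi≡j = ψ (inj₁ i) , 1<x , x<a , a<αx
    where
    1<x : oneH {suc n} Fin.< ψ (inj₁ i)
    1<x = subst (1 <_) (sym (toℕ-ψ (inj₁ i))) (s≤s 1≤i)
    x<a : ψ (inj₁ i) Fin.< α (oneH {suc n})
    x<a = subst₂ _<_ (sym (toℕ-ψ (inj₁ i))) (sym toℕ-α-one) (s≤s (s≤s i≤m))
    toℕ-αx : toℕ (α (ψ (inj₁ i))) ≡ 2 + m + toℕ j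
    toℕ-αx = trans (cong toℕ (trans (α-ψ (inj₁ i)) (cong ψ βi≡j)))
                   (trans (toℕ-ψ (inj₂ j)) (position-inj₂ j 1≤j))
    a<αx : α (oneH {suc n}) Fin.< α (ψ (inj₁ i))
    a<αx = subst₂ _<_ (sym toℕ-α-one) (sym toℕ-αx) (m<m+n (2 + m) 1≤j)

module Cut {n : ℕ} (u : UMap (suc n)) (cross : CrossCond u) where
  open UMap u

  a : Fin (H (suc n))
  a = α (oneH {suc n})

  2≤a : 2 ≤ toℕ a
  2≤a = let (_ , 1<x , x<a , _) = cross in <-trans 1<x x<a

  a≤2n+2 : toℕ a ≤ 2 * suc n
  a≤2n+2 = s≤s⁻¹ (≤∧≢⇒< (s≤s⁻¹ (Fin.toℕ<n a)) a≢p)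
    where
    a≢p : toℕ a ≢ suc (2 * suc n)
    a≢p e = 0≢1+n (sym (cong toℕ
      (α≡pH⇒≡rH u (Fin.toℕ-injective (trans e (sym (Fin.toℕ-fromℕ _)))))))

  m k : ℕ
  m = toℕ a ∸ 2
  k = 2 * n ∸ m

  split : m + k ≡ 2 * n
  split = m+[n∸m]≡n (subst (m ≤_) (cong (_∸ 2) (*-suc 2 n)) (∸-monoˡ-≤ 2 a≤2n+2))

  open Relabel n m k split

  toℕ-a : toℕ a ≡ 2 + m
  toℕ-a = sym (m+[n∸m]≡n 2≤a)

  a≡ψp₁ : a ≡ ψ p₁
  a≡ψp₁ = Fin.toℕ-injective (trans toℕ-a (sym toℕ-ψ-p₁))

  β : L m k → L m k
  β = ψ⁻¹ ∘ α ∘ ψ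

  β-involutive : ∀ x → β (β x) ≡ x
  β-involutive x =
    trans (cong (ψ⁻¹ ∘ α) (ψ-ψ⁻¹ (α (ψ x)))) (trans (cong ψ⁻¹ (invol (ψ x))) (ψ⁻¹-ψ x))

  β-fixed-point-free : ∀ x → β x ≢ x
  β-fixed-point-free x βx≡x = fpf (ψ x) (trans (sym (ψ-ψ⁻¹ (α (ψ x)))) (cong ψ βx≡x))

  β-r₁ : β r₁ ≡ p₁
  β-r₁ = trans (cong (ψ⁻¹ ∘ α) ψ-r₁) (trans (cong ψ⁻¹ a≡ψp₁) (ψ⁻¹-ψ p₁))

  β-r₂ : β r₂ ≡ p₂
  β-r₂ = trans (cong (ψ⁻¹ ∘ α) ψ-r₂) (trans (cong ψ⁻¹ (trans plant (sym ψ-p₂))) (ψ⁻¹-ψ p₂))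

  Link : Set
  Link = ∃ λ (i : Fin (2 + m)) → ∃ λ (j : Fin (2 + k)) →
           1 ≤ toℕ i × toℕ i ≤ m × 1 ≤ toℕ j × toℕ j ≤ k × β (inj₁ i) ≡ inj₂ j

  -- The first face occupies exactly the positions strictly between 1 and a, so a crossing
  -- edge leaves it.
  link-of-crossing : ∀ x → oneH {suc n} Fin.< x → x Fin.< a → a Fin.< α x → Link
  link-of-crossing x 1<x x<a a<αx = from-first-face (ψ⁻¹ x) (ψ-ψ⁻¹ x)
    where
    toℕ-via : ∀ y {t} → ψ y ≡ t → toℕ t ≡ position y
    toℕ-via y refl = toℕ-ψ y

    from-first-face : ∀ y → ψ y ≡ x → Link
    from-first-face (inj₂ Fin.zero) ψy≡x = ⊥-elim (n≮0 (subst (1 <_) (toℕ-via r₂ ψy≡x) 1<x))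
    from-first-face (inj₂ (Fin.suc j)) ψy≡x =
      ⊥-elim (<⇒≱ (subst₂ _<_ (toℕ-via (inj₂ (Fin.suc j)) ψy≡x) toℕ-a x<a)
                  (s≤s (s≤s (≤-trans (m≤m+n m (toℕ j)) (n≤1+n _)))))
    from-first-face (inj₁ i) ψy≡x =
      to-second-face (β (inj₁ i)) refl (trans (ψ-ψ⁻¹ _) (cong α ψy≡x))
      where
      1≤i : 1 ≤ toℕ i
      1≤i = s≤s⁻¹ (subst (1 <_) (toℕ-via (inj₁ i) ψy≡x) 1<x)
      i≤m : toℕ i ≤ m
      i≤m = s≤s⁻¹ (s≤s⁻¹ (subst₂ _<_ (toℕ-via (inj₁ i) ψy≡x) toℕ-a x<a))

      to-second-face : ∀ w → β (inj₁ i) ≡ w → ψ w ≡ α x → Link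
      to-second-face (inj₁ i′) _ ψw≡αx =
        ⊥-elim (<⇒≱ (subst₂ _<_ toℕ-a (toℕ-via (inj₁ i′) ψw≡αx) a<αx) (Fin.toℕ<n i′))
      to-second-face (inj₂ Fin.zero) _ ψw≡αx =
        ⊥-elim (n≮0 (subst (toℕ a <_) (toℕ-via r₂ ψw≡αx) a<αx))
      to-second-face (inj₂ (Fin.suc j)) βi≡w ψw≡αx with toℕ j ≟ k
      ... | no j≢k  =
        i , Fin.suc j , 1≤i , i≤m , s≤s z≤n , ≤∧≢⇒< (s≤s⁻¹ (Fin.toℕ<n j)) j≢k , βi≡w
      ... | yes j≡k = ⊥-elim (n≮0 (subst (1 <_) (cong toℕ x≡r) 1<x))
        where
        x≡r : x ≡ rH {suc n}
        x≡r = α≡pH⇒≡rH u (begin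
          α x                   ≡⟨ ψw≡αx ⟨
          ψ (inj₂ (Fin.suc j))  ≡⟨ cong ψ (suc-last j j≡k) ⟩
          ψ p₂                  ≡⟨ ψ-p₂ ⟩
          pH {suc n}            ∎)
          where open ≡-Reasoning

  cut : BMap n
  cut = record
    { m = m ; k = k ; split = split ; β = β ; invol = β-involutive ; fpf = β-fixed-point-free
    ; plant₁ = β-r₁ ; plant₂ = β-r₂
    ; link = let (x , 1<x , x<a , a<αx) = cross in link-of-crossing x 1<x x<a a<αx
    }

  private
    module G = Glue cut

  glued-cut : ∀ x → G.α x ≡ α x
  glued-cut x = trans (ψ-ψ⁻¹ _) (cong α (ψ-ψ⁻¹ x))

  vertices-cut : verticesB cut ≡ suc (verticesU u)
  vertices-cut =
    trans G.vertices-glued (cong suc (numCycles-cong Fin._≟_ (allFin _) (glued-cut ∘ next)))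

  sameCycle-one⇒plants : SameCycle (σU u) (oneH {suc n}) a → SameCycle (τB cut) r₁ r₂
  sameCycle-one⇒plants c = G.sameCycle-one⇒plants (sameCycle-cong (sym ∘ glued-cut ∘ next)
    (subst (SameCycle (σU u) (oneH {suc n})) (sym (glued-cut (oneH {suc n}))) c))

  sameCycle-plants⇒one : SameCycle (τB cut) r₁ r₂ → SameCycle (σU u) (oneH {suc n}) a
  sameCycle-plants⇒one c = subst (SameCycle (σU u) (oneH {suc n})) (glued-cut (oneH {suc n}))
    (sameCycle-cong (glued-cut ∘ next) (G.sameCycle-plants⇒one c))

glued-injective : ∀ {n} {P : BMap n → Set} (p q : Σ (BMap n) P) →
                  (∀ x → Glue.α (proj₁ p) x ≡ Glue.α (proj₁ q) x) → _≈B_ p q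
glued-injective {n} {P} p q e = same-shape p q m≡m′ k≡k′ e
  where
  open ≡-Reasoning
  m k : Σ (BMap n) P → ℕ
  m = BMap.m ∘ proj₁
  k = BMap.k ∘ proj₁

  m≡m′ : m p ≡ m q
  m≡m′ = +-cancelˡ-≡ 2 _ _ (begin
    2 + m p                                   ≡⟨ Glue.toℕ-α-one (proj₁ p) ⟨
    toℕ (Glue.α (proj₁ p) (oneH {suc n}))     ≡⟨ cong toℕ (e (oneH {suc n})) ⟩
    toℕ (Glue.α (proj₁ q) (oneH {suc n}))     ≡⟨ Glue.toℕ-α-one (proj₁ q) ⟩
    2 + m q                                   ∎)

  k≡k′ : k p ≡ k q
  k≡k′ = +-cancelˡ-≡ (m q) _ _ (begin
    m q + k p   ≡⟨ cong (_+ k p) m≡m′ ⟨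
    m p + k p   ≡⟨ BMap.split (proj₁ p) ⟩
    2 * n       ≡⟨ BMap.split (proj₁ q) ⟨
    m q + k q   ∎)

  same-shape : (p q : Σ (BMap n) P) → m p ≡ m q → k p ≡ k q →
               (∀ x → Glue.α (proj₁ p) x ≡ Glue.α (proj₁ q) x) → _≈B_ p q
  same-shape (b@record { m = m₀ ; k = k₀ } , _) (b′@record { m = .m₀ ; k = .k₀ } , _) refl refl e =
    sameB λ x → Glue.ψ-injective b
      (trans (sym (Glue.α-ψ b x)) (trans (e (Glue.ψ b x)) (Glue.α-ψ b′ x)))

glue-cong : ∀ {n} {P : BMap n → Set} {p q : Σ (BMap n) P} → _≈B_ p q →
            ∀ x → Glue.α (proj₁ p) x ≡ Glue.α (proj₁ q) x
glue-cong {p = b , _} (sameB β≡β′) x = cong (Glue.ψ b) (β≡β′ (Glue.ψ⁻¹ b x))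

genus-step : ∀ V g → V + 2 * suc g ≡ suc (suc V + 2 * g)
genus-step V g =
  trans (cong (V +_) (*-suc 2 g)) (trans (+-suc V (suc (2 * g))) (cong suc (+-suc V (2 * g))))

genus-glued : ∀ {n g} (b : BMap n) → HasGenusB g b → HasGenusU (suc g) (Glue.glued b)
genus-glued {g = g} b genus =
  trans (genus-step _ g) (cong suc (trans (cong (_+ 2 * g) (sym (Glue.vertices-glued b))) genus))

genus-cut : ∀ {n g} (u : UMap (suc n)) (cross : CrossCond u) →
            HasGenusU (suc g) u → HasGenusB g (Cut.cut u cross)
genus-cut {g = g} u cross genus = suc-injective
  (trans (cong (λ V → suc (V + 2 * g)) (Cut.vertices-cut u cross)) (trans (sym (genus-step _ g)) genus))

module Bijection (g n : ℕ) where

  glue-I : Σ (BMap n) (IsBI g) → Σ (UMap (suc n)) (IsUI (suc g))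
  glue-I (b , genus , ¬plants) =
    Glue.glued b , genus-glued b genus , ¬plants ∘ Glue.sameCycle-one⇒plants b , Glue.cross-glued b

  glue-II : Σ (BMap n) (IsBII g) → Σ (UMap (suc n)) (IsUII (suc g))
  glue-II (b , genus , plants) =
    Glue.glued b , genus-glued b genus , Glue.sameCycle-plants⇒one b plants , Glue.cross-glued b

  cut-I : Σ (UMap (suc n)) (IsUI (suc g)) → Σ (BMap n) (IsBI g)
  cut-I (u , genus , ¬one , cross) =
    Cut.cut u cross , genus-cut u cross genus , ¬one ∘ Cut.sameCycle-plants⇒one u cross

  cut-II : Σ (UMap (suc n)) (IsUII (suc g)) → Σ (BMap n) (IsBII g)
  cut-II (u , genus , one , cross) =
    Cut.cut u cross , genus-cut u cross genus , Cut.sameCycle-one⇒plants u cross one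

  glued-cut-I : ∀ w x → Glue.α (proj₁ (cut-I w)) x ≡ UMap.α (proj₁ w) x
  glued-cut-I (u , _ , _ , cross) = Cut.glued-cut u cross

  glued-cut-II : ∀ w x → Glue.α (proj₁ (cut-II w)) x ≡ UMap.α (proj₁ w) x
  glued-cut-II (u , _ , _ , cross) = Cut.glued-cut u cross

  η : Inverse (BIₛ g n ⊎ₛ BIIₛ g n) (UIₛ (suc g) (suc n) ⊎ₛ UIIₛ (suc g) (suc n))
  η = record
    { to        = Sum.map glue-I glue-II
    ; from      = Sum.map cut-I cut-II
    ; to-cong   = λ { (Pointwise.inj₁ r) → Pointwise.inj₁ (glue-cong r)
                    ; (Pointwise.inj₂ r) → Pointwise.inj₂ (glue-cong r) }
    ; from-cong = λ
        { {inj₁ w} {inj₁ w′} (Pointwise.inj₁ r) → Pointwise.inj₁ (glued-injective (cut-I w) (cut-I w′)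
            λ x → trans (glued-cut-I w x) (trans (r x) (sym (glued-cut-I w′ x))))
        ; {inj₂ w} {inj₂ w′} (Pointwise.inj₂ r) → Pointwise.inj₂ (glued-injective (cut-II w) (cut-II w′)
            λ x → trans (glued-cut-II w x) (trans (r x) (sym (glued-cut-II w′ x)))) }
    ; inverse   =
      (λ { {inj₁ w} (Pointwise.inj₁ r) → Pointwise.inj₁ λ x → trans (glue-cong r x) (glued-cut-I w x)
         ; {inj₂ w} (Pointwise.inj₂ r) → Pointwise.inj₂ λ x → trans (glue-cong r x) (glued-cut-II w x) }) ,
      (λ { {inj₁ p} {inj₁ w} (Pointwise.inj₁ r) →
             Pointwise.inj₁ (glued-injective (cut-I w) p λ x → trans (glued-cut-I w x) (r x))
         ; {inj₂ p} {inj₂ w} (Pointwise.inj₂ r) →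
             Pointwise.inj₂ (glued-injective (cut-II w) p λ x → trans (glued-cut-II w x) (r x)) })
    }

lemma2 : (g n : ℕ) → 1 ≤ n →
    Σ (Inverse (BIₛ g n ⊎ₛ BIIₛ g n) (UIₛ (suc g) (suc n) ⊎ₛ UIIₛ (suc g) (suc n))) λ η →
    (∀ b → ∃ λ u → Inverse.to η (inj₁ b) ≡ inj₁ u) ×
    (∀ b → ∃ λ u → Inverse.to η (inj₂ b) ≡ inj₂ u)
lemma2 g n _ = η , (λ b → glue-I b , refl) , (λ b → glue-II b , refl)
  where open Bijection g n
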